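{- Let $(\mathcal{P},\mathcal{L})$ be an antipodal plane of order $s$, let $P\in\mathcal{P}$ and $\ell\in\mathcal{L}$. If $P\in\ell$, then $P^\perp\in\ell^\perp$. Consequently $\ell^\perp$ consists of the $s+1$ points $Q^\perp$, $Q\in\ell$.
   Context: An antipodal plane of order $s\geq2$ is a partial linear space $(\mathcal{P},\mathcal{L})$ (lines are subsets of $\mathcal{P}$ of size at least $2$, two distinct points on at most one line) with $|\mathcal{P}|=|\mathcal{L}|=s^2+s+2$, every line containing $s+1$ points and every point on $s+1$ lines. For each point $P$ there is a unique point $P^\perp\neq P$ not lying on a common line with $P$ (the antipodal point), and for each line $\ell$ there is a unique line $\ell^\perp$ disjoint from $\ell$ (the antipodal line). -}

module Defs where

open import Data.Nat using (ℕ; _+_; _*_; _≤_)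
open import Data.Bool using (Bool; T)
open import Data.Fin using (Fin)
open import Data.Fin.Subset using (Subset; ∣_∣)
open import Data.Vec using (tabulate)
open import Data.Product using (Σ; _×_; ∃)
open import Relation.Binary.PropositionalEquality using (_≡_; _≢_)
open import Relation.Nullary using (¬_)

record IncStr (n m : ℕ) : Set where
  field
    inc : Fin n → Fin m → Bool

  _∈L_ : Fin n → Fin m → Set
  P ∈L ℓ = T (inc P ℓ)

  pointsOf : Fin m → Subset n
  pointsOf ℓ = tabulate (λ P → inc P ℓ)

  linesThrough : Fin n → Subset m
  linesThrough P = tabulate (λ ℓ → inc P ℓ)

  Collinear : Fin n → Fin n → Set
  Collinear P Q = ∃ λ ℓ → P ∈L ℓ × Q ∈L ℓ

  Disjoint : Fin m → Fin m → Set
  Disjoint ℓ k = ∀ P → P ∈L ℓ → ¬ (P ∈L k)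

  IsAntiPt : Fin n → Fin n → Set
  IsAntiPt P P' = P' ≢ P × ¬ Collinear P P'

  IsAntiLine : Fin m → Fin m → Set
  IsAntiLine ℓ k = Disjoint ℓ k

record IsAntipodalPlane (s : ℕ) (S : IncStr (s * s + s + 2) (s * s + s + 2)) : Set where
  open IncStr S
  field
    order≥2       : 2 ≤ s
    partialLinear : ∀ {P Q ℓ k} → P ≢ Q → P ∈L ℓ → Q ∈L ℓ → P ∈L k → Q ∈L k → ℓ ≡ k
    lineSize      : ∀ ℓ → ∣ pointsOf ℓ ∣ ≡ s + 1
    pointDegree   : ∀ P → ∣ linesThrough P ∣ ≡ s + 1
    antiPt        : ∀ P → ∃ λ P' → IsAntiPt P P'
    antiPtUnique  : ∀ {P P' P''} → IsAntiPt P P' → IsAntiPt P P'' → P' ≡ P''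
    antiLine       : ∀ ℓ → ∃ λ k → IsAntiLine ℓ k
    antiLineUnique : ∀ {ℓ k k'} → IsAntiLine ℓ k → IsAntiLine ℓ k' → k ≡ k'

{-# OPTIONS --safe #-}
-- Let P lie on ℓ and let ℓ' be the line disjoint from ℓ. Joining P to the points of ℓ'
-- gives distinct lines (two points of ℓ' span ℓ' itself, which misses P), none of them ℓ.
-- The s + 1 points of ℓ' cannot be joined injectively to the only s lines through P other
-- than ℓ, so some R ∈ ℓ' is not collinear with P; R ≠ P as P ∉ ℓ', hence R = P⊥.
module Submission where

open import Defs
open import Data.Nat using (ℕ; _+_; _*_; _≤_; _<_; z≤n)
open import Data.Nat.Properties using (≤-<-trans; <-irrefl)
open import Data.Bool using (Bool; T)
open import Data.Bool.Properties using (T-≡)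
open import Data.Fin using (Fin; zero; suc)
open import Data.Fin.Properties using (any?; _≟_; 0≢1+n; suc-injective)
open import Data.Fin.Subset using (Subset; ∣_∣; _∈_; _-_; inside; outside)
open import Data.Fin.Subset.Properties using (x∈p∧x≢y⇒x∈p-y; x∈p⇒∣p-x∣<∣p∣)
open import Data.Vec using (tabulate; _∷_; [])
open import Data.Vec.Base using (here; there)
open import Data.Vec.Properties using (lookup∘tabulate; lookup⇒[]=; []=⇒lookup)
open import Data.Product using (_×_; ∃; _,_; proj₁)
open import Function.Bundles using (Equivalence)
open import Relation.Nullary using (¬_; Dec; yes; no; contradiction)
open import Relation.Nullary.Decidable using (T?; ¬?; _×-dec_; decidable-stable)
open import Relation.Binary.PropositionalEquality using (_≡_; refl; sym; trans; subst)

injection⇒∣p∣≤∣q∣ : ∀ {n m} {p : Subset n} {q : Subset m} (f : ∀ x → x ∈ p → Fin m) →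
                    (∀ x x∈p → f x x∈p ∈ q) →
                    (∀ x y x∈p y∈p → f x x∈p ≡ f y y∈p → x ≡ y) →
                    ∣ p ∣ ≤ ∣ q ∣
injection⇒∣p∣≤∣q∣ {p = []} f f∈q f-inj = z≤n
injection⇒∣p∣≤∣q∣ {p = outside ∷ p} f f∈q f-inj =
  injection⇒∣p∣≤∣q∣ (λ x x∈p → f (suc x) (there x∈p))
    (λ x x∈p → f∈q (suc x) (there x∈p))
    (λ x y x∈p y∈p e → suc-injective (f-inj (suc x) (suc y) (there x∈p) (there y∈p) e))
injection⇒∣p∣≤∣q∣ {p = inside ∷ p} {q} f f∈q f-inj =
  ≤-<-trans ∣p∣≤∣q-f₀∣ (x∈p⇒∣p-x∣<∣p∣ (f∈q zero here))
  where
  ∣p∣≤∣q-f₀∣ : ∣ p ∣ ≤ ∣ q - f zero here ∣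
  ∣p∣≤∣q-f₀∣ = injection⇒∣p∣≤∣q∣ (λ x x∈p → f (suc x) (there x∈p))
    (λ x x∈p → x∈p∧x≢y⇒x∈p-y (f∈q (suc x) (there x∈p))
                 (λ e → 0≢1+n (sym (f-inj (suc x) zero (there x∈p) here e))))
    (λ x y x∈p y∈p e → suc-injective (f-inj (suc x) (suc y) (there x∈p) (there y∈p) e))

∈tabulate⁺ : ∀ {n} (f : Fin n → Bool) {i} → T (f i) → i ∈ tabulate f
∈tabulate⁺ f {i} t = lookup⇒[]= i _ (trans (lookup∘tabulate f i) (Equivalence.to T-≡ t))

∈tabulate⁻ : ∀ {n} (f : Fin n → Bool) {i} → i ∈ tabulate f → T (f i)
∈tabulate⁻ f {i} i∈ = Equivalence.from T-≡ (trans (sym (lookup∘tabulate f i)) ([]=⇒lookup i∈))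

module IncStrProperties {n m : ℕ} (S : IncStr n m) where
  open IncStr S

  ∈L⇒∈pointsOf : ∀ {P ℓ} → P ∈L ℓ → P ∈ pointsOf ℓ
  ∈L⇒∈pointsOf {ℓ = ℓ} = ∈tabulate⁺ (λ P → inc P ℓ)

  ∈pointsOf⇒∈L : ∀ {P ℓ} → P ∈ pointsOf ℓ → P ∈L ℓ
  ∈pointsOf⇒∈L {ℓ = ℓ} = ∈tabulate⁻ (λ P → inc P ℓ)

  ∈L⇒∈linesThrough : ∀ {P ℓ} → P ∈L ℓ → ℓ ∈ linesThrough P
  ∈L⇒∈linesThrough {P} = ∈tabulate⁺ (inc P)

  collinear? : ∀ P Q → Dec (Collinear P Q)
  collinear? P Q = any? (λ ℓ → T? (inc P ℓ) ×-dec T? (inc Q ℓ))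

  IsAntiPt-sym : ∀ {P Q} → IsAntiPt P Q → IsAntiPt Q P
  IsAntiPt-sym (Q≢P , ¬PQ) = (λ e → Q≢P (sym e)) , (λ (ℓ , Q∈ℓ , P∈ℓ) → ¬PQ (ℓ , P∈ℓ , Q∈ℓ))

  IsAntiLine-sym : ∀ {ℓ k} → IsAntiLine ℓ k → IsAntiLine k ℓ
  IsAntiLine-sym ℓ∩k=∅ P P∈k P∈ℓ = ℓ∩k=∅ P P∈ℓ P∈k

module AntipodalPlaneProperties {s : ℕ} {S : IncStr (s * s + s + 2) (s * s + s + 2)}
                                (A : IsAntipodalPlane s S) where
  open IncStr S
  open IncStrProperties S
  open IsAntipodalPlane A

  ¬collinear-with-all-of-antiLine : ∀ {P ℓ ℓ'} → P ∈L ℓ → IsAntiLine ℓ ℓ' →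
                                    ¬ (∀ R → R ∈L ℓ' → Collinear P R)
  ¬collinear-with-all-of-antiLine {P} {ℓ} {ℓ'} P∈ℓ ℓ∩ℓ'=∅ join =
    <-irrefl refl (≤-<-trans points≤lines lines<s+1)
    where
    line : ∀ R → R ∈ pointsOf ℓ' → Fin (s * s + s + 2)
    line R R∈ℓ' = proj₁ (join R (∈pointsOf⇒∈L R∈ℓ'))

    line-∈ : ∀ R R∈ℓ' → line R R∈ℓ' ∈ linesThrough P - ℓ
    line-∈ R R∈ℓ' with join R (∈pointsOf⇒∈L R∈ℓ')
    ... | k , P∈k , R∈k =
      x∈p∧x≢y⇒x∈p-y (∈L⇒∈linesThrough P∈k)
        (λ k≡ℓ → ℓ∩ℓ'=∅ R (subst (R ∈L_) k≡ℓ R∈k) (∈pointsOf⇒∈L R∈ℓ'))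

    line-injective : ∀ R R' R∈ℓ' R'∈ℓ' → line R R∈ℓ' ≡ line R' R'∈ℓ' → R ≡ R'
    line-injective R R' R∈ℓ' R'∈ℓ' e
      with R ≟ R' | join R (∈pointsOf⇒∈L R∈ℓ') | join R' (∈pointsOf⇒∈L R'∈ℓ')
    ... | yes R≡R' | _ | _ = R≡R'
    ... | no R≢R' | k , P∈k , R∈k | k' , _ , R'∈k' =
      contradiction (subst (P ∈L_) k≡ℓ' P∈k) (ℓ∩ℓ'=∅ P P∈ℓ)
      where
      k≡ℓ' : k ≡ ℓ'
      k≡ℓ' = partialLinear R≢R' R∈k (subst (R' ∈L_) (sym e) R'∈k')
               (∈pointsOf⇒∈L R∈ℓ') (∈pointsOf⇒∈L R'∈ℓ')

    points≤lines : s + 1 ≤ ∣ linesThrough P - ℓ ∣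
    points≤lines = subst (_≤ ∣ linesThrough P - ℓ ∣) (lineSize ℓ')
      (injection⇒∣p∣≤∣q∣ line line-∈ line-injective)

    lines<s+1 : ∣ linesThrough P - ℓ ∣ < s + 1
    lines<s+1 = subst (∣ linesThrough P - ℓ ∣ <_) (pointDegree P)
      (x∈p⇒∣p-x∣<∣p∣ (∈L⇒∈linesThrough P∈ℓ))

  ∃-nonCollinear-on-antiLine : ∀ {P ℓ ℓ'} → P ∈L ℓ → IsAntiLine ℓ ℓ' →
                               ∃ λ R → R ∈L ℓ' × ¬ Collinear P R
  ∃-nonCollinear-on-antiLine {P} {ℓ} {ℓ'} P∈ℓ ℓ∩ℓ'=∅
    with any? (λ R → T? (inc R ℓ') ×-dec ¬? (collinear? P R))
  ... | yes witness = witness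
  ... | no none = contradiction
    (λ R R∈ℓ' → decidable-stable (collinear? P R) (λ ¬PR → none (R , R∈ℓ' , ¬PR)))
    (¬collinear-with-all-of-antiLine P∈ℓ ℓ∩ℓ'=∅)

  antiPt-∈-antiLine : ∀ {P P' ℓ ℓ'} → IsAntiPt P P' → IsAntiLine ℓ ℓ' → P ∈L ℓ → P' ∈L ℓ'
  antiPt-∈-antiLine {P} {ℓ' = ℓ'} P⊥P' ℓ∩ℓ'=∅ P∈ℓ with ∃-nonCollinear-on-antiLine P∈ℓ ℓ∩ℓ'=∅
  ... | R , R∈ℓ' , ¬PR = subst (_∈L ℓ') (sym (antiPtUnique P⊥P' P⊥R)) R∈ℓ'
    where
    P⊥R : IsAntiPt P R
    P⊥R = (λ R≡P → ℓ∩ℓ'=∅ P P∈ℓ (subst (_∈L ℓ') R≡P R∈ℓ')) , ¬PR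

mainTheorem11 : (s : ℕ) (S : IncStr (s * s + s + 2) (s * s + s + 2)) → IsAntipodalPlane s S →
    let open IncStr S in
    (∀ (P P' : Fin (s * s + s + 2)) (ℓ ℓ' : Fin (s * s + s + 2)) →
       IsAntiPt P P' → IsAntiLine ℓ ℓ' → P ∈L ℓ → P' ∈L ℓ')
    × (∀ (ℓ ℓ' : Fin (s * s + s + 2)) → IsAntiLine ℓ ℓ' →
         (∀ R → R ∈L ℓ' → ∃ λ Q → Q ∈L ℓ × IsAntiPt Q R)
         × (∀ Q R → Q ∈L ℓ → IsAntiPt Q R → R ∈L ℓ')
         × (∀ Q₁ Q₂ R → Q₁ ∈L ℓ → Q₂ ∈L ℓ → IsAntiPt Q₁ R → IsAntiPt Q₂ R → Q₁ ≡ Q₂))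
mainTheorem11 s S A =
    (λ P P' ℓ ℓ' → antiPt-∈-antiLine)
  , λ ℓ ℓ' ℓ∩ℓ'=∅ →
      (λ R R∈ℓ' → let R' , R⊥R' = antiPt R in
        R' , antiPt-∈-antiLine R⊥R' (IsAntiLine-sym ℓ∩ℓ'=∅) R∈ℓ' , IsAntiPt-sym R⊥R')
    , (λ Q R Q∈ℓ Q⊥R → antiPt-∈-antiLine Q⊥R ℓ∩ℓ'=∅ Q∈ℓ)
    , (λ Q₁ Q₂ R _ _ Q₁⊥R Q₂⊥R → antiPtUnique (IsAntiPt-sym Q₁⊥R) (IsAntiPt-sym Q₂⊥R))
  where
  open IsAntipodalPlane A
  open IncStrProperties S
  open AntipodalPlaneProperties A
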